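{- Let $T_1,T_2$ be two brooms on a complete split graph $G$ and consider any sequence of rotations transforming $T_1$ into $T_2$. For each $u\in Y$ let $x_u=1$ if $u$ is a leaf of some broom along the sequence, and $x_u=0$ if $u$ remains in the handle of all brooms of the sequence. Then the number of rotations in the sequence is at least $$\mathrm{inv}(\sigma)+\sum_{u\in Q\setminus Y}|A_u|+\sum_{u\in Y}\bigl(|B_u|+2|C_u|x_u+|D_u|(1-x_u)\bigr)+\frac12\sum_{u\in Y}\sum_{v\in E_u}(1+x_u)(1-x_v)+2\sum_{u\in Y}\sum_{v\in F_u}x_u(1-x_v).$$
   Context: A complete split graph $G$ has vertex set partitioned into $P$ ($|P|=p\ge 1$) inducing a clique and $Q$ ($|Q|=q$) inducing an independent set, with every vertex of $P$ adjacent to every vertex of $Q$. A broom on $G$ consists of a handle, a sequence of vertices listed from top (root) to bottom whose elements are exactly $P\cup S$ for some $S\subseteq Q$, with bottommost element in $P$, together with the set $Q\setminus S$ of leaves attached to the bottommost handle vertex; $u$ is above $v$ if it comes earlier in the handle. A rotation is one of: (1) exchange two consecutive handle vertices $u$ (directly above) and $v$, provided that if $v$ is bottommost then $u\in P$; (2) if the vertex $u$ directly above the bottommost handle vertex is in $Q$, remove $u$ from the handle and make it a leaf; (3) remove a leaf and insert it into the handle directly above the bottommost handle vertex. Notation for the fixed brooms $T_1,T_2$: $Y$ is the set of vertices of $Q$ lying in the handles of both $T_1$ and $T_2$. $\sigma$ is the permutation of $\{1,\dots,p\}$ obtained by labeling the vertices of $P$ from $1$ to $p$ in their top-to-bottom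 order in the handle of $T_1$ and reading these labels top to bottom in the handle of $T_2$; $\mathrm{inv}(\sigma)$ is its number of inversions. For $u\in Q\setminus Y$: if $u$ lies in the handle of one of $T_1,T_2$, $A_u$ is the set of vertices of $P$ below $u$ in that handle; otherwise $A_u=\emptyset$. For $u\in Y$: $B_u$ is the set of vertices of $P$ above $u$ in one of $T_1,T_2$ and below $u$ in the other; $C_u$ is the set of vertices of $P$ below $u$ in both; $D_u$ is the set of vertices of $Q\setminus Y$ above $u$ in the handle of $T_1$ or of $T_2$; $E_u$ is the set of vertices of $Y$ above $u$ in one of $T_1,T_2$ and below $u$ in the other; $F_u$ is the set of vertices of $Y$ below $u$ in both. -}

module Defs where

open import Data.Nat using (ℕ; zero; suc; _+_; _*_; _∸_)
open import Data.Fin using (Fin; zero; suc; inject₁; fromℕ)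
import Data.Fin.Properties as FinP
open import Data.Sum using (_⊎_; inj₁; inj₂)
open import Data.Sum.Properties using (≡-dec)
open import Data.Bool using (Bool; true; false; if_then_else_; _∧_; _∨_; not; _xor_)
open import Data.List using (List; []; _∷_; _++_; allFin; map)
open import Data.Bool.ListAction using (any)
open import Data.Nat.ListAction using (sum)
open import Data.List.Membership.Propositional using (_∈_; _∉_)
open import Data.List.Relation.Unary.Unique.Propositional using (Unique)
open import Data.Product using (Σ; ∃; _×_; _,_)
open import Relation.Nullary using (¬_)
open import Relation.Nullary.Decidable using (⌊_⌋)
open import Relation.Binary.PropositionalEquality using (_≡_)

-- Complete split graph with clique P = Fin p and independent set Q = Fin q.
-- Vertices are  inj₁ i  (i ∈ P)  or  inj₂ u  (u ∈ Q).

V : ℕ → ℕ → Set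
V p q = Fin p ⊎ Fin q

_==_ : ∀ {p q} → V p q → V p q → Bool
a == b = ⌊ ≡-dec FinP._≟_ FinP._≟_ a b ⌋

mem : ∀ {p q} → V p q → List (V p q) → Bool
mem a h = any (_== a) h

after : ∀ {p q} → V p q → List (V p q) → List (V p q)
after a []       = []
after a (x ∷ xs) = if x == a then xs else after a xs

above : ∀ {p q} → List (V p q) → V p q → V p q → Bool
above h a b = mem b (after a h)

-- Brooms.  A broom is represented by its handle (top to bottom); the
-- leaves are exactly the vertices of Q not in the handle.

IsP : ∀ {p q} → V p q → Set
IsP {p} {q} v = ∃ λ (i : Fin p) → v ≡ inj₁ i

record IsBroom {p q : ℕ} (h : List (V p q)) : Set where
  field
    distinct   : Unique h
    containsP  : ∀ (i : Fin p) → inj₁ i ∈ h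
    bottomInP  : ∃ λ (xs : List (V p q)) → ∃ λ (i : Fin p) → h ≡ xs ++ (inj₁ i ∷ [])

isLeaf : ∀ {p q} → List (V p q) → Fin q → Bool
isLeaf h u = not (mem (inj₂ u) h)

data Rotation {p q : ℕ} : List (V p q) → List (V p q) → Set where
  swap   : ∀ (xs : List (V p q)) (u v : V p q) (ys : List (V p q)) →
           (ys ≡ [] → IsP u) →
           Rotation (xs ++ u ∷ v ∷ ys) (xs ++ v ∷ u ∷ ys)
  toLeaf : ∀ (xs : List (V p q)) (u : Fin q) (b : V p q) →
           Rotation (xs ++ inj₂ u ∷ b ∷ []) (xs ++ b ∷ [])
  fromLeaf : ∀ (xs : List (V p q)) (u : Fin q) (b : V p q) →
           inj₂ u ∉ (xs ++ b ∷ []) →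
           Rotation (xs ++ b ∷ []) (xs ++ inj₂ u ∷ b ∷ [])

record RotSeq {p q : ℕ} (h₁ h₂ : List (V p q)) (k : ℕ) : Set where
  field
    B      : Fin (suc k) → List (V p q)
    brooms : ∀ j → IsBroom (B j)
    start  : B zero ≡ h₁
    end    : B (fromℕ k) ≡ h₂
    steps  : ∀ (j : Fin k) → Rotation (B (inject₁ j)) (B (suc j))
open RotSeq public

Σ[_] : ∀ n → (Fin n → ℕ) → ℕ
Σ[ n ] f = sum (map f (allFin n))

ΣWhere : ∀ n → (Fin n → Bool) → (Fin n → ℕ) → ℕ
ΣWhere n P f = Σ[ n ] (λ i → if P i then f i else 0)

#[_] : ∀ n → (Fin n → Bool) → ℕ
#[ n ] P = ΣWhere n P (λ _ → 1)

module Quantities {p q : ℕ} (h₁ h₂ : List (V p q)) where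

  inQ : Fin q → V p q
  inQ = inj₂

  inP : Fin p → V p q
  inP = inj₁

  inY : Fin q → Bool
  inY u = mem (inQ u) h₁ ∧ mem (inQ u) h₂

  -- inv(σ): number of pairs of P-vertices whose relative order in the
  -- handle of T₂ is reversed with respect to the handle of T₁
  -- (i above j in T₁, j above i in T₂)
  invσ : ℕ
  invσ = Σ[ p ] (λ i → #[ p ] (λ j → above h₁ (inP i) (inP j) ∧ above h₂ (inP j) (inP i)))

  -- |A_u| for u ∈ Q \ Y : P-vertices below u in the handle (of T₁ or T₂)
  -- containing u; 0 if u is in neither handle
  cardA : Fin q → ℕ
  cardA u = #[ p ] (λ i → above h₁ (inQ u) (inP i) ∨ above h₂ (inQ u) (inP i))

  cardB : Fin q → ℕ
  cardB u = #[ p ] (λ i → (above h₁ (inP i) (inQ u) ∧ above h₂ (inQ u) (inP i))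
                        ∨ (above h₁ (inQ u) (inP i) ∧ above h₂ (inP i) (inQ u)))

  cardC : Fin q → ℕ
  cardC u = #[ p ] (λ i → above h₁ (inQ u) (inP i) ∧ above h₂ (inQ u) (inP i))

  cardD : Fin q → ℕ
  cardD u = #[ q ] (λ v → not (inY v) ∧ (above h₁ (inQ v) (inQ u) ∨ above h₂ (inQ v) (inQ u)))

  inE : Fin q → Fin q → Bool
  inE u v = inY v ∧ ((above h₁ (inQ v) (inQ u) ∧ above h₂ (inQ u) (inQ v))
                   ∨ (above h₁ (inQ u) (inQ v) ∧ above h₂ (inQ v) (inQ u)))

  inF : Fin q → Fin q → Bool
  inF u v = inY v ∧ above h₁ (inQ u) (inQ v) ∧ above h₂ (inQ u) (inQ v)

xval : ∀ {p q} {h₁ h₂ : List (V p q)} {k : ℕ} → RotSeq h₁ h₂ k → Fin q → ℕ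
xval {k = k} S u = if any (λ j → isLeaf (B S j) u) (allFin (suc k)) then 1 else 0

-- Twice the lower bound of Lemma 3.1 (doubled to avoid the factor 1/2).
twiceBound : ∀ {p q} {h₁ h₂ : List (V p q)} {k : ℕ} → RotSeq h₁ h₂ k → ℕ
twiceBound {p} {q} {h₁} {h₂} S =
    2 * invσ
  + 2 * ΣWhere q (λ u → not (inY u)) cardA
  + 2 * ΣWhere q inY (λ u → cardB u + 2 * cardC u * x u + cardD u * (1 ∸ x u))
  + ΣWhere q inY (λ u → ΣWhere q (inE u) (λ v → (1 + x u) * (1 ∸ x v)))
  + 4 * ΣWhere q inY (λ u → ΣWhere q (inF u) (λ v → x u * (1 ∸ x v)))
  where
    open Quantities h₁ h₂
    x : Fin q → ℕ
    x = xval S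

{-# OPTIONS --safe #-}
module Submission where

-- Charge every rotation to the pair of vertices whose relative position it changes (the two
-- exchanged vertices, or the vertex of Q leaving or entering the handle together with the
-- bottommost vertex). Each rotation is charged to one unordered pair, so the charges of all
-- ordered pairs add up to at most 2k. The relative order of a and b in the handle only changes
-- at a rotation charged to {a , b}, unless b itself leaves or enters the handle. So if b is
-- never a leaf, (a , b) is charged at least once when its order differs in T₁ and T₂, and at
-- least twice when a is above b in both but is a leaf at some moment: the order is lost and
-- restored. Pair by pair (P × P, Q × P and Q × Q) these lower bounds dominate the terms of the
-- bound, which is a finite check on Booleans.

open import Defs
open import Data.Nat using (ℕ; _≤_; _*_)
open import Data.List using (List)

open import Data.Nat.Properties
open import Data.Bool.Properties
  using (T-≡; T-not-≡; T-∧; ∨-assoc; ∨-comm; ∨-zeroʳ; ∧-comm; ∨-commutativeMonoid) renaming (_≟_ to _≟ᵇ_)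
open import Algebra.Bundles using (CommutativeMonoid)
open import Algebra.Properties.CommutativeMonoid.Sum +-0-commutativeMonoid
  using (sum-cong-≗; ∑-distrib-+; ∑-comm) renaming (sum to ∑)
open import Algebra.Properties.CommutativeSemigroup +-commutativeSemigroup
  using () renaming (interchange to +-interchange)
open import Algebra.Properties.CommutativeSemigroup
  (CommutativeMonoid.commutativeSemigroup ∨-commutativeMonoid)
  using () renaming (x∙yz≈y∙xz to ∨-x∙yz≈y∙xz)
open import Algebra.Properties.Semiring.Sum +-*-semiring using (*-distribˡ-sum; *-distribʳ-sum)
open import Data.Bool using (Bool; true; false; if_then_else_; _∧_; _∨_; not; _xor_; T)
open import Data.Bool.ListAction using (any)
open import Data.Empty using (⊥-elim)
open import Data.Fin as Fin using (Fin; toℕ; inject₁; fromℕ)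
open import Data.Fin.Properties using (≤fromℕ) renaming (_≟_ to _≟ᶠ_; suc-injective to Fin-suc-injective)
open import Data.List using ([]; _∷_; _++_; allFin)
import Data.List.Properties as List
open import Data.List.Membership.Propositional using (_∈_; _∉_; lose)
open import Data.List.Membership.Propositional.Properties using (∈-allFin)
open import Data.List.Relation.Unary.All.Properties using (All¬⇒¬Any)
open import Data.List.Relation.Unary.AllPairs using (_∷_)
open import Data.List.Relation.Unary.Any using (here; there; satisfied)
open import Data.List.Relation.Unary.Any.Properties using (any⁺; any⁻)
open import Data.List.Relation.Unary.Unique.Propositional using (Unique)
open import Data.List.Relation.Unary.Unique.Propositional.Properties using (Unique[x∷xs]⇒x∉xs)
open import Data.Nat using (zero; suc; _+_; _∸_; _⊔_; _<_; _≤ᵇ_; z≤n; s≤s)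
open import Data.Nat.ListAction using (sum)
open import Data.Nat.Tactic.RingSolver using (solve-∀)
open import Data.Product using (∃; _×_; _,_; proj₁; proj₂)
open import Data.Sum using (_⊎_; inj₁; inj₂)
open import Data.Sum.Properties as Sum using (≡-dec)
open import Data.Vec using (Vec; []; _∷_)
open import Data.Vec.N-ary using (N-ary; _$ⁿ_)
open import Function using (_∘_; id; flip; Equivalence)
open import Relation.Nullary using (yes; no)
open import Relation.Nullary.Decidable using (toWitness; isYes≗does; dec-true)
open import Relation.Binary.PropositionalEquality
  using (_≡_; _≢_; ≢-sym; refl; sym; trans; cong; cong₂; subst; setoid; module ≡-Reasoning)

[_] : Bool → ℕ
[ b ] = if b then 1 else 0

Σ-suc : ∀ n (f : Fin (suc n) → ℕ) → Σ[ suc n ] f ≡ f Fin.zero + Σ[ n ] (f ∘ Fin.suc)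
Σ-suc n f = cong (λ xs → f Fin.zero + sum xs)
  (trans (List.map-tabulate Fin.suc f) (sym (List.map-tabulate id (f ∘ Fin.suc))))

Σ≡∑ : ∀ n (f : Fin n → ℕ) → Σ[ n ] f ≡ ∑ f
Σ≡∑ zero    f = refl
Σ≡∑ (suc n) f = trans (Σ-suc n f) (cong (f Fin.zero +_) (Σ≡∑ n (f ∘ Fin.suc)))

Σ-cong : ∀ n {f g : Fin n → ℕ} → (∀ i → f i ≡ g i) → Σ[ n ] f ≡ Σ[ n ] g
Σ-cong n {f} {g} f≗g = trans (Σ≡∑ n f) (trans (sum-cong-≗ f≗g) (sym (Σ≡∑ n g)))

Σ-mono : ∀ n {f g : Fin n → ℕ} → (∀ i → f i ≤ g i) → Σ[ n ] f ≤ Σ[ n ] g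
Σ-mono zero    f≤g = z≤n
Σ-mono (suc n) {f} {g} f≤g rewrite Σ-suc n f | Σ-suc n g =
  +-mono-≤ (f≤g Fin.zero) (Σ-mono n (f≤g ∘ Fin.suc))

Σ-+ : ∀ n (f g : Fin n → ℕ) → Σ[ n ] (λ i → f i + g i) ≡ Σ[ n ] f + Σ[ n ] g
Σ-+ n f g = trans (Σ≡∑ n _) (trans (∑-distrib-+ f g) (sym (cong₂ _+_ (Σ≡∑ n f) (Σ≡∑ n g))))

Σ-*ˡ : ∀ n c (f : Fin n → ℕ) → Σ[ n ] (λ i → c * f i) ≡ c * Σ[ n ] f
Σ-*ˡ n c f = trans (Σ≡∑ n _) (trans (sym (*-distribˡ-sum c f)) (sym (cong (c *_) (Σ≡∑ n f))))

Σ-*ʳ : ∀ n c (f : Fin n → ℕ) → Σ[ n ] (λ i → f i * c) ≡ Σ[ n ] f * c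
Σ-*ʳ n c f = trans (Σ≡∑ n _) (trans (sym (*-distribʳ-sum c f)) (sym (cong (_* c) (Σ≡∑ n f))))

Σ-swap : ∀ m n (f : Fin m → Fin n → ℕ) →
         Σ[ m ] (λ i → Σ[ n ] (f i)) ≡ Σ[ n ] (λ j → Σ[ m ] (λ i → f i j))
Σ-swap m n f = begin
  Σ[ m ] (λ i → Σ[ n ] (f i))         ≡⟨ Σ-cong m (λ i → Σ≡∑ n (f i)) ⟩
  Σ[ m ] (λ i → ∑ (f i))              ≡⟨ Σ≡∑ m _ ⟩
  ∑ (λ i → ∑ (f i))                   ≡⟨ ∑-comm f ⟩
  ∑ (λ j → ∑ (λ i → f i j))           ≡⟨ sym (Σ≡∑ n _) ⟩
  Σ[ n ] (λ j → ∑ (λ i → f i j))      ≡⟨ sym (Σ-cong n (λ j → Σ≡∑ m (λ i → f i j))) ⟩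
  Σ[ n ] (λ j → Σ[ m ] (λ i → f i j)) ∎
  where open ≡-Reasoning

Σ-const : ∀ n c → Σ[ n ] (λ _ → c) ≡ n * c
Σ-const zero    c = refl
Σ-const (suc n) c = trans (Σ-suc n (λ _ → c)) (cong (c +_) (Σ-const n c))

Σ-zero : ∀ n {f : Fin n → ℕ} → (∀ i → f i ≡ 0) → Σ[ n ] f ≡ 0
Σ-zero n f≗0 = trans (Σ-cong n f≗0) (trans (Σ-const n 0) (*-zeroʳ n))

Σ²-+ : ∀ m n (f g : Fin m → Fin n → ℕ) →
       Σ[ m ] (λ i → Σ[ n ] (λ j → f i j + g i j))
         ≡ Σ[ m ] (λ i → Σ[ n ] (f i)) + Σ[ m ] (λ i → Σ[ n ] (g i))
Σ²-+ m n f g = trans (Σ-cong m (λ i → Σ-+ n (f i) (g i))) (Σ-+ m _ _)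

ΣWhere-+ : ∀ n P (f g : Fin n → ℕ) → ΣWhere n P (λ i → f i + g i) ≡ ΣWhere n P f + ΣWhere n P g
ΣWhere-+ n P f g = trans (Σ-cong n if-+) (Σ-+ n _ _)
  where
  if-+ : ∀ i → (if P i then f i + g i else 0) ≡ (if P i then f i else 0) + (if P i then g i else 0)
  if-+ i with P i
  ... | true  = refl
  ... | false = refl

ΣWhere-Σ : ∀ m n P (f : Fin m → Fin n → ℕ) →
           ΣWhere m P (λ i → Σ[ n ] (f i)) ≡ Σ[ m ] (λ i → Σ[ n ] (λ j → if P i then f i j else 0))
ΣWhere-Σ m n P f = Σ-cong m if-Σ
  where
  if-Σ : ∀ i → (if P i then Σ[ n ] (f i) else 0) ≡ Σ[ n ] (λ j → if P i then f i j else 0)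
  if-Σ i with P i
  ... | true  = refl
  ... | false = sym (Σ-zero n (λ _ → refl))

Σ-single : ∀ n (f : Fin n → ℕ) i → f i ≤ Σ[ n ] f
Σ-single (suc n) f Fin.zero    rewrite Σ-suc n f = m≤m+n _ _
Σ-single (suc n) f (Fin.suc i) rewrite Σ-suc n f = ≤-trans (Σ-single n (f ∘ Fin.suc) i) (m≤n+m _ _)

Σ-pair : ∀ n (f : Fin n → ℕ) i j → toℕ i < toℕ j → f i + f j ≤ Σ[ n ] f
Σ-pair (suc n) f Fin.zero    (Fin.suc j) _ rewrite Σ-suc n f =
  +-monoʳ-≤ (f Fin.zero) (Σ-single n (f ∘ Fin.suc) j)
Σ-pair (suc n) f (Fin.suc i) (Fin.suc j) (s≤s i<j) rewrite Σ-suc n f =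
  ≤-trans (Σ-pair n (f ∘ Fin.suc) i j i<j) (m≤n+m _ _)

Σ-atMostOne : ∀ n (P : Fin n → Bool) → (∀ i j → P i ≡ true → P j ≡ true → i ≡ j) →
              Σ[ n ] (λ i → [ P i ]) ≤ 1
Σ-atMostOne zero    P unique = z≤n
Σ-atMostOne (suc n) P unique rewrite Σ-suc n (λ i → [ P i ]) with P Fin.zero in P0
... | true  = ≤-reflexive (cong suc (Σ-zero n nowhere-else))
  where
  nowhere-else : ∀ i → [ P (Fin.suc i) ] ≡ 0
  nowhere-else i with P (Fin.suc i) in Pi
  ... | true  with () ← unique _ _ P0 Pi
  ... | false = refl
... | false = Σ-atMostOne n (P ∘ Fin.suc) (λ i j Pi Pj → Fin-suc-injective (unique _ _ Pi Pj))

allᵇ : ∀ n → (Vec Bool n → Bool) → Bool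
allᵇ zero    P = P []
allᵇ (suc n) P = allᵇ n (P ∘ (false ∷_)) ∧ allᵇ n (P ∘ (true ∷_))

allᵇ-sound : ∀ n (P : Vec Bool n → Bool) → T (allᵇ n P) → ∀ v → T (P v)
allᵇ-sound zero    P t [] = t
allᵇ-sound (suc n) P t (false ∷ v) = allᵇ-sound n _ (proj₁ (Equivalence.to T-∧ t)) v
allᵇ-sound (suc n) P t (true  ∷ v) = allᵇ-sound n _ (proj₂ (Equivalence.to T-∧ t)) v

-- A claim (e , l , r) in n Boolean variables reads “l ≤ r unless e”. It is proved by
-- evaluating it at all 2ⁿ arguments, so the argument ok is just tt.
decide-≤ : ∀ n (claim : N-ary n Bool (Bool × ℕ × ℕ)) →
           T (allᵇ n (λ v → let (e , l , r) = claim $ⁿ v in e ∨ (l ≤ᵇ r))) →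
           ∀ v → proj₁ (claim $ⁿ v) ≡ false → proj₁ (proj₂ (claim $ⁿ v)) ≤ proj₂ (proj₂ (claim $ⁿ v))
decide-≤ n claim ok v ¬e with claim $ⁿ v | allᵇ-sound n _ ok v
... | (e , l , r) | l≤ᵇr rewrite ¬e = ≤ᵇ⇒≤ l r l≤ᵇr

∨-≢ʳ⇒true : ∀ x y → x ∨ y ≢ y → x ≡ true
∨-≢ʳ⇒true true  y _  = refl
∨-≢ʳ⇒true false y ne = ⊥-elim (ne refl)

true-false⇒≢ : ∀ {x y : Bool} → x ≡ true → y ≡ false → x ≢ y
true-false⇒≢ refl refl ()

∧≡false : ∀ {b c : Bool} → (b ≡ true → c ≡ false) → b ∧ c ≡ false
∧≡false {true}  b⇒¬c = b⇒¬c refl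
∧≡false {false} _    = refl

module _ {p q : ℕ} where

  ==⇒≡ : {a b : V p q} → a == b ≡ true → a ≡ b
  ==⇒≡ {a} {b} e = toWitness {a? = ≡-dec _≟ᶠ_ _≟ᶠ_ a b} (Equivalence.from T-≡ e)

  ==-refl : ∀ (a : V p q) → a == a ≡ true
  ==-refl a = trans (isYes≗does (≡-dec _≟ᶠ_ _≟ᶠ_ a a)) (dec-true (≡-dec _≟ᶠ_ _≟ᶠ_ a a) refl)

  mem⇒∈ : ∀ a (h : List (V p q)) → mem a h ≡ true → a ∈ h
  mem⇒∈ a (x ∷ h) e with x == a in x=a
  ... | true  = here (sym (==⇒≡ x=a))
  ... | false = there (mem⇒∈ a h e)

  ∉⇒mem-false : ∀ a (h : List (V p q)) → a ∉ h → mem a h ≡ false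
  ∉⇒mem-false a h a∉h with mem a h in e
  ... | true  = ⊥-elim (a∉h (mem⇒∈ a h e))
  ... | false = refl

  mem-++ : ∀ b (xs ys : List (V p q)) → mem b (xs ++ ys) ≡ mem b xs ∨ mem b ys
  mem-++ b []       ys = refl
  mem-++ b (x ∷ xs) ys = trans (cong (x == b ∨_) (mem-++ b xs ys)) (sym (∨-assoc (x == b) _ _))

  after-++ : ∀ a (xs ys : List (V p q)) →
             after a (xs ++ ys) ≡ (if mem a xs then after a xs ++ ys else after a ys)
  after-++ a []       ys = refl
  after-++ a (x ∷ xs) ys with x == a
  ... | true  = refl
  ... | false = after-++ a xs ys

  above-++ : ∀ (xs ys : List (V p q)) a b →
             above (xs ++ ys) a b ≡ (if mem a xs then mem b (after a xs) ∨ mem b ys else above ys a b)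
  above-++ xs ys a b rewrite after-++ a xs ys with mem a xs
  ... | true  = mem-++ b (after a xs) ys
  ... | false = refl

  mem-after⇒mem : ∀ a b (h : List (V p q)) → mem b (after a h) ≡ true → mem b h ≡ true
  mem-after⇒mem a b (x ∷ h) e with x == a
  ... | true  rewrite e                     = ∨-zeroʳ (x == b)
  ... | false rewrite mem-after⇒mem a b h e = ∨-zeroʳ (x == b)

  above⇒mem : ∀ (h : List (V p q)) a b → above h a b ≡ true → mem a h ≡ true
  above⇒mem (x ∷ h) a b e with x == a
  ... | true  = refl
  ... | false = above⇒mem h a b e

  above-absent : ∀ (h : List (V p q)) a b → mem a h ≡ false → above h a b ≡ false
  above-absent []      a b _  = refl
  above-absent (x ∷ h) a b a∉ with x == a
  above-absent (x ∷ h) a b () | true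
  ... | false = above-absent h a b a∉

  ∉⇒mem-after-false : ∀ a b (h : List (V p q)) → a ∉ h → mem a (after b h) ≡ false
  ∉⇒mem-after-false a b h a∉h with mem a (after b h) in e
  ... | true  = ⊥-elim (a∉h (mem⇒∈ a h (mem-after⇒mem b a h e)))
  ... | false = refl

  above-antisym : ∀ (h : List (V p q)) → Unique h → ∀ a b → above h a b ≡ true → above h b a ≡ false
  above-antisym (x ∷ h) (x∉h ∷ uh) a b e with x == a in x=a | x == b in x=b
  ... | false | false = above-antisym h uh a b e
  ... | true  | true  = ∉⇒mem-false a h (subst (_∉ h) (==⇒≡ x=a) (All¬⇒¬Any x∉h))
  ... | true  | false = ∉⇒mem-after-false a b h (subst (_∉ h) (==⇒≡ x=a) (All¬⇒¬Any x∉h))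
  ... | false | true  =
    ⊥-elim (subst (_∉ h) (==⇒≡ x=b) (All¬⇒¬Any x∉h) (mem⇒∈ b h (mem-after⇒mem a b h e)))

  Unique-++-∷⇒mem-false : ∀ (xs : List (V p q)) y zs → Unique (xs ++ y ∷ zs) → mem y (xs ++ zs) ≡ false
  Unique-++-∷⇒mem-false xs y zs u =
    ∉⇒mem-false y (xs ++ zs) (Unique[x∷xs]⇒x∉xs (Unique-resp-↭ (↭-shift xs zs) u))
    where open import Data.List.Relation.Binary.Permutation.Setoid.Properties (setoid (V p q))
            using (Unique-resp-↭; ↭-shift)

-- A rotation changes the relative order of one pair only

module _ {p q : ℕ} where

  IsPair : V p q × V p q → V p q → V p q → Set
  IsPair (c₁ , c₂) a b = (c₁ ≡ a × c₂ ≡ b) ⊎ (c₂ ≡ a × c₁ ≡ b)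

  matches : V p q × V p q → V p q → V p q → Bool
  matches (c₁ , c₂) a b = (c₁ == a ∧ c₂ == b) ∨ (c₂ == a ∧ c₁ == b)

  IsPair⇒matches : ∀ c a b → IsPair c a b → matches c a b ≡ true
  IsPair⇒matches _ a b (inj₁ (refl , refl)) rewrite ==-refl a | ==-refl b = refl
  IsPair⇒matches _ a b (inj₂ (refl , refl)) rewrite ==-refl a | ==-refl b = ∨-zeroʳ _

  matches-sym : ∀ c a b → matches c a b ≡ matches c b a
  matches-sym (c₁ , c₂) a b =
    trans (∨-comm (c₁ == a ∧ c₂ == b) _)
          (cong₂ _∨_ (∧-comm (c₂ == a) (c₁ == b)) (∧-comm (c₁ == a) (c₂ == b)))

  movedPair : {h h' : List (V p q)} → Rotation h h' → V p q × V p q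
  movedPair (swap _ u v _ _)   = u , v
  movedPair (toLeaf _ u c)     = inj₂ u , c
  movedPair (fromLeaf _ u c _) = inj₂ u , c

  above-swap : ∀ xs u v ys a b →
               above (xs ++ u ∷ v ∷ ys) a b ≢ above (xs ++ v ∷ u ∷ ys) a b → IsPair (u , v) a b
  above-swap xs u v ys a b ne rewrite above-++ xs (u ∷ v ∷ ys) a b | above-++ xs (v ∷ u ∷ ys) a b
    with mem a xs
  ... | true  = ⊥-elim (ne (cong (mem b (after a xs) ∨_) (∨-x∙yz≈y∙xz (u == b) (v == b) (mem b ys))))
  ... | false with u == a in u=a | v == a in v=a
  ...   | true  | true  = ⊥-elim (ne (cong (λ w → mem b (w ∷ ys)) (trans (==⇒≡ v=a) (sym (==⇒≡ u=a)))))
  ...   | true  | false = inj₁ (==⇒≡ u=a , ==⇒≡ (∨-≢ʳ⇒true (v == b) (mem b ys) ne))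
  ...   | false | true  = inj₂ (==⇒≡ v=a , ==⇒≡ (∨-≢ʳ⇒true (u == b) (mem b ys) (ne ∘ sym)))
  ...   | false | false = ⊥-elim (ne refl)

  above-toLeaf : ∀ xs u c a b → above (xs ++ inj₂ u ∷ c ∷ []) a b ≢ above (xs ++ c ∷ []) a b →
                 IsPair (inj₂ u , c) a b ⊎ b ≡ inj₂ u
  above-toLeaf xs u c a b ne rewrite above-++ xs (inj₂ u ∷ c ∷ []) a b | above-++ xs (c ∷ []) a b
    with mem a xs
  ... | true  = inj₂ (sym (==⇒≡ (∨-≢ʳ⇒true (inj₂ u == b) _ (ne ∘ cong (mem b (after a xs) ∨_)))))
  ... | false with inj₂ u == a in u=a
  ...   | false = ⊥-elim (ne refl)
  ...   | true  with c == a
  ...     | true  = inj₁ (inj₁ (==⇒≡ u=a , ==⇒≡ (∨-≢ʳ⇒true (c == b) false ne)))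
  ...     | false = inj₁ (inj₁ (==⇒≡ u=a , ==⇒≡ (∨-≢ʳ⇒true (c == b) false ne)))

  rotation-local : ∀ {h h' : List (V p q)} (r : Rotation h h') → Unique h → ∀ a b →
                   above h a b ≢ above h' a b →
                   IsPair (movedPair r) a b
                     ⊎ ∃ λ w → b ≡ inj₂ w × (isLeaf h w ≡ true ⊎ isLeaf h' w ≡ true)
  rotation-local (swap xs u v ys _) _ a b ne = inj₁ (above-swap xs u v ys a b ne)
  rotation-local (toLeaf xs u c) uh a b ne with above-toLeaf xs u c a b ne
  ... | inj₁ m   = inj₁ m
  ... | inj₂ b≡u = inj₂ (u , b≡u , inj₂ (cong not (Unique-++-∷⇒mem-false xs (inj₂ u) (c ∷ []) uh)))
  rotation-local (fromLeaf xs u c u∉) _ a b ne with above-toLeaf xs u c a b (ne ∘ sym)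
  ... | inj₁ m   = inj₁ m
  ... | inj₂ b≡u = inj₂ (u , b≡u , inj₁ (cong not (∉⇒mem-false (inj₂ u) (xs ++ c ∷ []) u∉)))

-- Charging rotations to pairs of vertices

step-between : ∀ k (f : Fin (suc k) → Bool) (i j : Fin (suc k)) → toℕ i ≤ toℕ j → f i ≢ f j →
               ∃ λ (s : Fin k) → toℕ i ≤ toℕ s × toℕ s < toℕ j × f (inject₁ s) ≢ f (Fin.suc s)
step-between k       f Fin.zero    Fin.zero    _         fi≢fj = ⊥-elim (fi≢fj refl)
step-between (suc k) f Fin.zero    (Fin.suc j) _         fi≢fj
  with f Fin.zero ≟ᵇ f (Fin.suc Fin.zero)
... | no  f₀≢f₁ = Fin.zero , z≤n , s≤s z≤n , f₀≢f₁
... | yes f₀≡f₁ with step-between k (f ∘ Fin.suc) Fin.zero j z≤n (fi≢fj ∘ trans f₀≡f₁)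
...   | s , _ , s<j , fs≢fs' = Fin.suc s , z≤n , s≤s s<j , fs≢fs'
step-between (suc k) f (Fin.suc i) (Fin.suc j) (s≤s i≤j) fi≢fj
  with step-between k (f ∘ Fin.suc) i j i≤j fi≢fj
... | s , i≤s , s<j , fs≢fs' = Fin.suc s , s≤s i≤s , s≤s s<j , fs≢fs'

module _ {p q : ℕ} where

  ΣV : (V p q → ℕ) → ℕ
  ΣV f = Σ[ p ] (f ∘ inj₁) + Σ[ q ] (f ∘ inj₂)

  ΣV-cong : {f g : V p q → ℕ} → (∀ a → f a ≡ g a) → ΣV f ≡ ΣV g
  ΣV-cong f≗g = cong₂ _+_ (Σ-cong p (f≗g ∘ inj₁)) (Σ-cong q (f≗g ∘ inj₂))

  ΣV-mono : {f g : V p q → ℕ} → (∀ a → f a ≤ g a) → ΣV f ≤ ΣV g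
  ΣV-mono f≤g = +-mono-≤ (Σ-mono p (f≤g ∘ inj₁)) (Σ-mono q (f≤g ∘ inj₂))

  ΣV-+ : (f g : V p q → ℕ) → ΣV (λ a → f a + g a) ≡ ΣV f + ΣV g
  ΣV-+ f g = trans (cong₂ _+_ (Σ-+ p (f ∘ inj₁) (g ∘ inj₁)) (Σ-+ q (f ∘ inj₂) (g ∘ inj₂)))
                    (+-interchange (Σ[ p ] (f ∘ inj₁)) _ _ _)

  ΣV-*ˡ : ∀ c (f : V p q → ℕ) → ΣV (λ a → c * f a) ≡ c * ΣV f
  ΣV-*ˡ c f = trans (cong₂ _+_ (Σ-*ˡ p c (f ∘ inj₁)) (Σ-*ˡ q c (f ∘ inj₂))) (sym (*-distribˡ-+ c _ _))

  ΣV-Σ : ∀ k (f : V p q → Fin k → ℕ) → ΣV (λ a → Σ[ k ] (f a)) ≡ Σ[ k ] (λ s → ΣV (λ a → f a s))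
  ΣV-Σ k f = trans (cong₂ _+_ (Σ-swap p k (f ∘ inj₁)) (Σ-swap q k (f ∘ inj₂)))
                   (sym (Σ-+ k (λ s → Σ[ p ] (λ i → f (inj₁ i) s)) (λ s → Σ[ q ] (λ w → f (inj₂ w) s))))

  ΣV-==≤1 : ∀ (c : V p q) → ΣV (λ a → [ c == a ]) ≤ 1
  ΣV-==≤1 (inj₁ i) rewrite Σ-zero q {λ w → [ inj₁ i == inj₂ w ]} (λ _ → refl) =
    ≤-trans (≤-reflexive (+-identityʳ _))
            (Σ-atMostOne p _ (λ j j' e e' → trans (sym (Sum.inj₁-injective (==⇒≡ {q = q} e)))
                                                         (Sum.inj₁-injective (==⇒≡ {q = q} e'))))
  ΣV-==≤1 (inj₂ w) rewrite Σ-zero p {λ i → [ inj₂ w == inj₁ i ]} (λ _ → refl) =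
    Σ-atMostOne q _ (λ j j' e e' → trans (sym (Sum.inj₂-injective (==⇒≡ {p = p} e)))
                                         (Sum.inj₂-injective (==⇒≡ {p = p} e')))

  [matches]≤ : ∀ (c₁ c₂ a b : V p q) →
               [ matches (c₁ , c₂) a b ] ≤ [ c₁ == a ] * [ c₂ == b ] + [ c₂ == a ] * [ c₁ == b ]
  [matches]≤ c₁ c₂ a b = decide-≤ 4
    (λ x y z w → false , [ (x ∧ y) ∨ (z ∧ w) ] , [ x ] * [ y ] + [ z ] * [ w ])
    _ (c₁ == a ∷ c₂ == b ∷ c₂ == a ∷ c₁ == b ∷ []) refl

  ΣΣ-matches≤2 : ∀ (c : V p q × V p q) → ΣV (λ a → ΣV (λ b → [ matches c a b ])) ≤ 2
  ΣΣ-matches≤2 (c₁ , c₂) = begin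
    ΣV (λ a → ΣV (λ b → [ matches (c₁ , c₂) a b ]))
      ≤⟨ ΣV-mono (λ a → ΣV-mono ([matches]≤ c₁ c₂ a)) ⟩
    ΣV (λ a → ΣV (λ b → [ c₁ == a ] * [ c₂ == b ] + [ c₂ == a ] * [ c₁ == b ]))
      ≡⟨ ΣV-cong (λ a → trans (ΣV-+ (λ b → [ c₁ == a ] * [ c₂ == b ]) (λ b → [ c₂ == a ] * [ c₁ == b ]))
                              (cong₂ _+_ (ΣV-*ˡ [ c₁ == a ] (λ b → [ c₂ == b ]))
                                         (ΣV-*ˡ [ c₂ == a ] (λ b → [ c₁ == b ])))) ⟩
    ΣV (λ a → [ c₁ == a ] * ΣV (λ b → [ c₂ == b ]) + [ c₂ == a ] * ΣV (λ b → [ c₁ == b ]))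
      ≤⟨ ΣV-mono (λ a → +-mono-≤ (*-monoʳ-≤ [ c₁ == a ] (ΣV-==≤1 c₂))
                                 (*-monoʳ-≤ [ c₂ == a ] (ΣV-==≤1 c₁))) ⟩
    ΣV (λ a → [ c₁ == a ] * 1 + [ c₂ == a ] * 1)
      ≡⟨ ΣV-cong (λ a → cong₂ _+_ (*-identityʳ [ c₁ == a ]) (*-identityʳ [ c₂ == a ])) ⟩
    ΣV (λ a → [ c₁ == a ] + [ c₂ == a ])
      ≡⟨ ΣV-+ (λ a → [ c₁ == a ]) (λ a → [ c₂ == a ]) ⟩
    ΣV (λ a → [ c₁ == a ]) + ΣV (λ a → [ c₂ == a ])
      ≤⟨ +-mono-≤ (ΣV-==≤1 c₁) (ΣV-==≤1 c₂) ⟩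
    2 ∎
    where open ≤-Reasoning

-- forced a₁ a₂ x y is a number of charges the ordered pair (a , b) must receive, where aᵢ tells
-- whether a is above b in Tᵢ, and x, y whether a, b are a leaf at some moment.
forced : (a₁ a₂ x y : Bool) → ℕ
forced a₁ a₂ x y = if y then 0 else [ a₁ xor a₂ ] + 2 * [ a₁ ∧ a₂ ∧ x ]

module Charges {p q : ℕ} {h₁ h₂ : List (V p q)} {k : ℕ} (S : RotSeq h₁ h₂ k) where

  charged : Fin k → V p q → V p q → Bool
  charged s = matches (movedPair (steps S s))

  charges : V p q → V p q → ℕ
  charges a b = Σ[ k ] (λ s → [ charged s a b ])

  charges-sym : ∀ a b → charges a b ≡ charges b a
  charges-sym a b = Σ-cong k (λ s → cong [_] (matches-sym (movedPair (steps S s)) a b))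

  ΣΣcharges≤2k : ΣV (λ a → ΣV (charges a)) ≤ 2 * k
  ΣΣcharges≤2k = begin
    ΣV (λ a → ΣV (charges a))
      ≡⟨ ΣV-cong (λ a → ΣV-Σ k (λ b s → [ charged s a b ])) ⟩
    ΣV (λ a → Σ[ k ] (λ s → ΣV (λ b → [ charged s a b ])))
      ≡⟨ ΣV-Σ k (λ a s → ΣV (λ b → [ charged s a b ])) ⟩
    Σ[ k ] (λ s → ΣV (λ a → ΣV (λ b → [ charged s a b ])))
      ≤⟨ Σ-mono k (λ s → ΣΣ-matches≤2 (movedPair (steps S s))) ⟩
    Σ[ k ] (λ _ → 2)
      ≡⟨ trans (Σ-const k 2) (*-comm k 2) ⟩
    2 * k ∎
    where open ≤-Reasoning

  wasLeaf : V p q → Bool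
  wasLeaf (inj₁ _) = false
  wasLeaf (inj₂ w) = any (λ j → isLeaf (B S j) w) (allFin (suc k))

  wasLeaf⇒absent : ∀ a → wasLeaf a ≡ true → ∃ λ j → mem a (B S j) ≡ false
  wasLeaf⇒absent (inj₂ w) leaf
    with satisfied (any⁻ (λ j → isLeaf (B S j) w) (allFin (suc k)) (Equivalence.from T-≡ leaf))
  ... | j , isLeaf-j = j , Equivalence.to T-not-≡ isLeaf-j

  never-leaf : ∀ w → wasLeaf (inj₂ w) ≡ false → ∀ j → isLeaf (B S j) w ≡ false
  never-leaf w never j with isLeaf (B S j) w in leaf
  ... | true  = ⊥-elim (subst T never
                  (any⁺ (λ j → isLeaf (B S j) w) (lose (∈-allFin j) (Equivalence.from T-≡ leaf))))
  ... | false = refl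

  step-charged : ∀ s a b → wasLeaf b ≡ false →
                 above (B S (inject₁ s)) a b ≢ above (B S (Fin.suc s)) a b → charged s a b ≡ true
  step-charged s a b never ne
    with rotation-local (steps S s) (IsBroom.distinct (brooms S (inject₁ s))) a b ne
  ... | inj₁ pair = IsPair⇒matches _ a b pair
  ... | inj₂ (w , refl , inj₁ leaf) with () ← trans (sym leaf) (never-leaf w never (inject₁ s))
  ... | inj₂ (w , refl , inj₂ leaf) with () ← trans (sym leaf) (never-leaf w never (Fin.suc s))

  order-change : ∀ a b → wasLeaf b ≡ false → ∀ i j → toℕ i ≤ toℕ j →
                 above (B S i) a b ≢ above (B S j) a b →
                 ∃ λ s → toℕ i ≤ toℕ s × toℕ s < toℕ j × [ charged s a b ] ≡ 1
  order-change a b never i j i≤j ne with step-between k (λ j → above (B S j) a b) i j i≤j ne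
  ... | s , i≤s , s<j , ne' = s , i≤s , s<j , cong [_] (step-charged s a b never ne')

  above-start : ∀ a b → above (B S Fin.zero) a b ≡ above h₁ a b
  above-start a b = cong (λ h → above h a b) (start S)

  above-end : ∀ a b → above (B S (fromℕ k)) a b ≡ above h₂ a b
  above-end a b = cong (λ h → above h a b) (end S)

  order-changed⇒1≤charges : ∀ a b → wasLeaf b ≡ false → above h₁ a b ≢ above h₂ a b → 1 ≤ charges a b
  order-changed⇒1≤charges a b never ne
    with order-change a b never Fin.zero (fromℕ k) z≤n
           (λ e → ne (trans (sym (above-start a b)) (trans e (above-end a b))))
  ... | s , _ , _ , charged-s = subst (_≤ charges a b) charged-s (Σ-single k (λ s → [ charged s a b ]) s)

  leaf-in-between⇒2≤charges : ∀ a b → wasLeaf b ≡ false → above h₁ a b ≡ true → above h₂ a b ≡ true →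
                              wasLeaf a ≡ true → 2 ≤ charges a b
  leaf-in-between⇒2≤charges a b never a<₁b a<₂b leaf
    with j , a∉Bj ← wasLeaf⇒absent a leaf
    with order-change a b never Fin.zero j z≤n
           (true-false⇒≢ (trans (above-start a b) a<₁b) (above-absent (B S j) a b a∉Bj))
       | order-change a b never j (fromℕ k) (≤fromℕ j)
           (≢-sym (true-false⇒≢ (trans (above-end a b) a<₂b) (above-absent (B S j) a b a∉Bj)))
  ... | s₁ , _ , s₁<j , c₁ | s₂ , j≤s₂ , _ , c₂ =
    subst (_≤ charges a b) (cong₂ _+_ c₁ c₂)
          (Σ-pair k (λ s → [ charged s a b ]) s₁ s₂ (<-≤-trans s₁<j j≤s₂))

  forced≤charges : ∀ a b → forced (above h₁ a b) (above h₂ a b) (wasLeaf a) (wasLeaf b) ≤ charges a b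
  forced≤charges a b with wasLeaf b in never
  ... | true  = z≤n
  ... | false with above h₁ a b in e₁ | above h₂ a b in e₂
  ...   | true  | false = order-changed⇒1≤charges a b never (true-false⇒≢ e₁ e₂)
  ...   | false | true  = order-changed⇒1≤charges a b never (≢-sym (true-false⇒≢ e₂ e₁))
  ...   | false | false = z≤n
  ...   | true  | true  with wasLeaf a in leaf
  ...     | true  = leaf-in-between⇒2≤charges a b never e₁ e₂ leaf
  ...     | false = z≤n

inversions≤forced : ∀ a a' b b' → (a ∧ a') ∨ (b ∧ b') ≡ false →
                    [ a ∧ b' ] + [ a' ∧ b ] ≤ forced a b false false
inversions≤forced a a' b b' = decide-≤ 4
  (λ a a' b b' → (a ∧ a') ∨ (b ∧ b') , [ a ∧ b' ] + [ a' ∧ b ] , forced a b false false)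
  _ (a ∷ a' ∷ b ∷ b' ∷ [])

outsideY≤forced : ∀ c₁ c₂ x → c₁ ∧ c₂ ≡ false → [ c₁ ∨ c₂ ] ≤ forced c₁ c₂ x false
outsideY≤forced c₁ c₂ x = decide-≤ 3
  (λ c₁ c₂ x → c₁ ∧ c₂ , [ c₁ ∨ c₂ ] , forced c₁ c₂ x false)
  _ (c₁ ∷ c₂ ∷ x ∷ [])

insideY≤forced : ∀ c₁ c₂ d₁ d₂ x → (c₁ ∧ d₁) ∨ (c₂ ∧ d₂) ≡ false →
                 [ (d₁ ∧ c₂) ∨ (c₁ ∧ d₂) ] + 2 * [ c₁ ∧ c₂ ] * [ x ] ≤ forced c₁ c₂ x false
insideY≤forced c₁ c₂ d₁ d₂ x = decide-≤ 5
  (λ c₁ c₂ d₁ d₂ x → (c₁ ∧ d₁) ∨ (c₂ ∧ d₂) ,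
                     [ (d₁ ∧ c₂) ∨ (c₁ ∧ d₂) ] + 2 * [ c₁ ∧ c₂ ] * [ x ] ,
                     forced c₁ c₂ x false)
  _ (c₁ ∷ c₂ ∷ d₁ ∷ d₂ ∷ x ∷ [])

-- The D-, E- and F-summands of twiceBound indexed by an ordered pair (u , v) of vertices of Q.
termsQQ : (yu yv xu xv a₁ a₁' a₂ a₂' : Bool) → ℕ
termsQQ yu yv xu xv a₁ a₁' a₂ a₂' =
    2 * (if yu then [ not yv ∧ (a₁' ∨ a₂') ] * (1 ∸ [ xu ]) else 0)
  + (if yu then (if yv ∧ ((a₁' ∧ a₂) ∨ (a₁ ∧ a₂')) then (1 + [ xu ]) * (1 ∸ [ xv ]) else 0) else 0)
  + 4 * (if yu then (if yv ∧ a₁ ∧ a₂ then [ xu ] * (1 ∸ [ xv ]) else 0) else 0)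

termsQQ-sym≤forced : ∀ yu yv xu xv a₁ a₁' a₂ a₂' →
                     ((a₁ ∧ a₁') ∨ (a₂ ∧ a₂')) ∨ ((not yu ∧ (a₁ ∧ a₂)) ∨ (not yv ∧ (a₁' ∧ a₂'))) ≡ false →
                     termsQQ yu yv xu xv a₁ a₁' a₂ a₂' + termsQQ yv yu xv xu a₁' a₁ a₂' a₂
                       ≤ 2 * (forced a₁ a₂ xu xv ⊔ forced a₁' a₂' xv xu)
termsQQ-sym≤forced yu yv xu xv a₁ a₁' a₂ a₂' = decide-≤ 8
  (λ yu yv xu xv a₁ a₁' a₂ a₂' →
     ((a₁ ∧ a₁') ∨ (a₂ ∧ a₂')) ∨ ((not yu ∧ (a₁ ∧ a₂)) ∨ (not yv ∧ (a₁' ∧ a₂'))) ,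
     termsQQ yu yv xu xv a₁ a₁' a₂ a₂' + termsQQ yv yu xv xu a₁' a₁ a₂' a₂ ,
     2 * (forced a₁ a₂ xu xv ⊔ forced a₁' a₂' xv xu))
  _ (yu ∷ yv ∷ xu ∷ xv ∷ a₁ ∷ a₁' ∷ a₂ ∷ a₂' ∷ [])

module Bound {p q : ℕ} {h₁ h₂ : List (V p q)} (u₁ : Unique h₁) (u₂ : Unique h₂)
            {k : ℕ} (S : RotSeq h₁ h₂ k) where
  open Quantities h₁ h₂
  open Charges S

  -- xval S u is [ wasLeaf (inQ u) ] by definition.
  x : Fin q → ℕ
  x = xval S

  above-antisym₁₂ : ∀ a b → (above h₁ a b ∧ above h₁ b a) ∨ (above h₂ a b ∧ above h₂ b a) ≡ false
  above-antisym₁₂ a b = cong₂ _∨_ (∧≡false (above-antisym h₁ u₁ a b)) (∧≡false (above-antisym h₂ u₂ a b))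

  ∉Y⇒¬above-both : ∀ u b → inY u ≡ false → above h₁ (inQ u) b ∧ above h₂ (inQ u) b ≡ false
  ∉Y⇒¬above-both u b u∉Y with above h₁ (inQ u) b in e₁ | above h₂ (inQ u) b in e₂
  ... | true  | true  with () ← trans (sym u∉Y) (cong₂ _∧_ (above⇒mem h₁ _ _ e₁) (above⇒mem h₂ _ _ e₂))
  ... | true  | false = refl
  ... | false | _     = refl

  PP : ℕ
  PP = Σ[ p ] (λ i → Σ[ p ] (λ j → charges (inP i) (inP j)))

  inversion : Fin p → Fin p → ℕ
  inversion i j = [ above h₁ (inP i) (inP j) ∧ above h₂ (inP j) (inP i) ]

  2invσ≤PP : 2 * invσ ≤ PP
  2invσ≤PP = begin
    2 * invσ
      ≡⟨ cong (invσ +_) (trans (+-identityʳ invσ) (Σ-swap p p inversion)) ⟩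
    invσ + Σ[ p ] (λ i → Σ[ p ] (λ j → inversion j i))
      ≡⟨ sym (Σ²-+ p p inversion (flip inversion)) ⟩
    Σ[ p ] (λ i → Σ[ p ] (λ j → inversion i j + inversion j i))
      ≤⟨ Σ-mono p (λ i → Σ-mono p (λ j → pair-bound i j)) ⟩
    PP ∎
    where
    open ≤-Reasoning
    pair-bound : ∀ i j → inversion i j + inversion j i ≤ charges (inP i) (inP j)
    pair-bound i j = ≤-trans
      (inversions≤forced (above h₁ (inP i) (inP j)) (above h₁ (inP j) (inP i))
                         (above h₂ (inP i) (inP j)) (above h₂ (inP j) (inP i))
                         (above-antisym₁₂ (inP i) (inP j)))
      (forced≤charges (inP i) (inP j))

  QP : ℕ
  QP = Σ[ q ] (λ u → Σ[ p ] (λ i → charges (inQ u) (inP i)))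

  ΣA ΣBC : ℕ
  ΣA  = ΣWhere q (λ u → not (inY u)) cardA
  ΣBC = ΣWhere q inY (λ u → cardB u + 2 * cardC u * x u)

  ΣA+ΣBC≤QP : ΣA + ΣBC ≤ QP
  ΣA+ΣBC≤QP = ≤-trans (≤-reflexive (sym (Σ-+ q _ _))) (Σ-mono q vertex-bound)
    where
    vertex-bound : ∀ u → (if not (inY u) then cardA u else 0)
                           + (if inY u then cardB u + 2 * cardC u * x u else 0)
                         ≤ Σ[ p ] (λ i → charges (inQ u) (inP i))
    vertex-bound u with inY u in u∈Y
    ... | false = ≤-trans (≤-reflexive (+-identityʳ _)) (Σ-mono p (λ i → ≤-trans
                    (outsideY≤forced (c₁ i) (c₂ i) (wasLeaf (inQ u)) (∉Y⇒¬above-both u (inP i) u∈Y))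
                    (forced≤charges (inQ u) (inP i))))
      where
      c₁ c₂ : Fin p → Bool
      c₁ i = above h₁ (inQ u) (inP i)
      c₂ i = above h₂ (inQ u) (inP i)
    ... | true = begin
      cardB u + 2 * cardC u * x u
        ≡⟨ cong (cardB u +_) (sym (trans (Σ-*ʳ p (x u) (λ i → 2 * [ c₁ i ∧ c₂ i ]))
                                         (cong (_* x u) (Σ-*ˡ p 2 (λ i → [ c₁ i ∧ c₂ i ]))))) ⟩
      cardB u + Σ[ p ] (λ i → 2 * [ c₁ i ∧ c₂ i ] * x u)
        ≡⟨ sym (Σ-+ p _ _) ⟩
      Σ[ p ] (λ i → [ (d₁ i ∧ c₂ i) ∨ (c₁ i ∧ d₂ i) ] + 2 * [ c₁ i ∧ c₂ i ] * x u)
        ≤⟨ Σ-mono p (λ i → ≤-trans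
             (insideY≤forced (c₁ i) (c₂ i) (d₁ i) (d₂ i) (wasLeaf (inQ u))
                             (above-antisym₁₂ (inQ u) (inP i)))
             (forced≤charges (inQ u) (inP i))) ⟩
      Σ[ p ] (λ i → charges (inQ u) (inP i)) ∎
      where
      open ≤-Reasoning
      c₁ c₂ d₁ d₂ : Fin p → Bool
      c₁ i = above h₁ (inQ u) (inP i)
      c₂ i = above h₂ (inQ u) (inP i)
      d₁ i = above h₁ (inP i) (inQ u)
      d₂ i = above h₂ (inP i) (inQ u)

  QQ : ℕ
  QQ = Σ[ q ] (λ u → Σ[ q ] (λ v → charges (inQ u) (inQ v)))

  ΣD ΣE 4ΣF : ℕ
  ΣD = ΣWhere q inY (λ u → cardD u * (1 ∸ x u))
  ΣE = ΣWhere q inY (λ u → ΣWhere q (inE u) (λ v → (1 + x u) * (1 ∸ x v)))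
  4ΣF = 4 * ΣWhere q inY (λ u → ΣWhere q (inF u) (λ v → x u * (1 ∸ x v)))

  ΣΣ : (Fin q → Fin q → ℕ) → ℕ
  ΣΣ f = Σ[ q ] (λ u → Σ[ q ] (f u))

  ΣΣ-*ˡ : ∀ c f → ΣΣ (λ u v → c * f u v) ≡ c * ΣΣ f
  ΣΣ-*ˡ c f = trans (Σ-cong q (λ u → Σ-*ˡ q c (f u))) (Σ-*ˡ q c _)

  termsQQ-at : Fin q → Fin q → ℕ
  termsQQ-at u v = termsQQ (inY u) (inY v) (wasLeaf (inQ u)) (wasLeaf (inQ v))
             (above h₁ (inQ u) (inQ v)) (above h₁ (inQ v) (inQ u))
             (above h₂ (inQ u) (inQ v)) (above h₂ (inQ v) (inQ u))

  2ΣD+ΣE+4ΣF≡ΣΣtermsQQ-at : 2 * ΣD + ΣE + 4ΣF ≡ ΣΣ termsQQ-at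
  2ΣD+ΣE+4ΣF≡ΣΣtermsQQ-at = begin
    2 * ΣD + ΣE + 4ΣF
      ≡⟨ cong₂ (λ a b → 2 * a + b + 4ΣF) ΣD≡ (ΣWhere-Σ q q inY _) ⟩
    2 * ΣΣ g₁ + ΣΣ g₂ + 4ΣF
      ≡⟨ cong₂ (λ a b → a + ΣΣ g₂ + 4 * b) (sym (ΣΣ-*ˡ 2 g₁)) (ΣWhere-Σ q q inY _) ⟩
    ΣΣ (λ u v → 2 * g₁ u v) + ΣΣ g₂ + 4 * ΣΣ g₃
      ≡⟨ cong (ΣΣ (λ u v → 2 * g₁ u v) + ΣΣ g₂ +_) (sym (ΣΣ-*ˡ 4 g₃)) ⟩
    ΣΣ (λ u v → 2 * g₁ u v) + ΣΣ g₂ + ΣΣ (λ u v → 4 * g₃ u v)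
      ≡⟨ cong (_+ ΣΣ (λ u v → 4 * g₃ u v)) (sym (Σ²-+ q q _ g₂)) ⟩
    ΣΣ (λ u v → 2 * g₁ u v + g₂ u v) + ΣΣ (λ u v → 4 * g₃ u v)
      ≡⟨ sym (Σ²-+ q q _ _) ⟩
    ΣΣ termsQQ-at ∎
    where
    open ≡-Reasoning
    g₁ g₂ g₃ : Fin q → Fin q → ℕ
    g₁ u v = if inY u
             then [ not (inY v) ∧ (above h₁ (inQ v) (inQ u) ∨ above h₂ (inQ v) (inQ u)) ] * (1 ∸ x u)
             else 0
    g₂ u v = if inY u then (if inE u v then (1 + x u) * (1 ∸ x v) else 0) else 0
    g₃ u v = if inY u then (if inF u v then x u * (1 ∸ x v) else 0) else 0
    ΣD≡ : ΣD ≡ ΣΣ g₁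
    ΣD≡ = trans (Σ-cong q (λ u → cong (λ n → if inY u then n else 0) (sym (Σ-*ʳ q (1 ∸ x u) _))))
                (ΣWhere-Σ q q inY _)

  ¬above-both-unless-Y : ∀ u b → not (inY u) ∧ (above h₁ (inQ u) b ∧ above h₂ (inQ u) b) ≡ false
  ¬above-both-unless-Y u b with inY u in u∈Y
  ... | true  = refl
  ... | false = ∉Y⇒¬above-both u b u∈Y

  termsQQ-at-sym≤2charges : ∀ u v → termsQQ-at u v + termsQQ-at v u ≤ 2 * charges (inQ u) (inQ v)
  termsQQ-at-sym≤2charges u v = ≤-trans
    (termsQQ-sym≤forced (inY u) (inY v) (wasLeaf (inQ u)) (wasLeaf (inQ v))
       (above h₁ (inQ u) (inQ v)) (above h₁ (inQ v) (inQ u))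
       (above h₂ (inQ u) (inQ v)) (above h₂ (inQ v) (inQ u))
       (cong₂ _∨_ (above-antisym₁₂ (inQ u) (inQ v))
                  (cong₂ _∨_ (¬above-both-unless-Y u (inQ v)) (¬above-both-unless-Y v (inQ u)))))
    (*-monoʳ-≤ 2 (⊔-lub (forced≤charges (inQ u) (inQ v))
                        (≤-trans (forced≤charges (inQ v) (inQ u))
                                 (≤-reflexive (charges-sym (inQ v) (inQ u))))))

  2ΣD+ΣE+4ΣF≤QQ : 2 * ΣD + ΣE + 4ΣF ≤ QQ
  2ΣD+ΣE+4ΣF≤QQ = *-cancelˡ-≤ 2 (begin
    2 * (2 * ΣD + ΣE + 4ΣF)
      ≡⟨ cong (2 *_) 2ΣD+ΣE+4ΣF≡ΣΣtermsQQ-at ⟩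
    2 * ΣΣ termsQQ-at
      ≡⟨ cong (ΣΣ termsQQ-at +_) (trans (+-identityʳ _) (Σ-swap q q termsQQ-at)) ⟩
    ΣΣ termsQQ-at + ΣΣ (λ u v → termsQQ-at v u)
      ≡⟨ sym (Σ²-+ q q termsQQ-at (flip termsQQ-at)) ⟩
    ΣΣ (λ u v → termsQQ-at u v + termsQQ-at v u)
      ≤⟨ Σ-mono q (λ u → Σ-mono q (termsQQ-at-sym≤2charges u)) ⟩
    ΣΣ (λ u v → 2 * charges (inQ u) (inQ v))
      ≡⟨ ΣΣ-*ˡ 2 _ ⟩
    2 * QQ ∎)
    where open ≤-Reasoning

  ΣΣcharges≡ : ΣV (λ a → ΣV (charges a)) ≡ PP + QP + (QP + QQ)
  ΣΣcharges≡ = cong₂ _+_ (trans (Σ-+ p _ _) (cong (PP +_) PQ≡QP)) (Σ-+ q _ _)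
    where
    PQ≡QP : Σ[ p ] (λ i → Σ[ q ] (λ w → charges (inP i) (inQ w))) ≡ QP
    PQ≡QP = trans (Σ-swap p q (λ i w → charges (inP i) (inQ w)))
                  (Σ-cong q (λ w → Σ-cong p (λ i → charges-sym (inP i) (inQ w))))

  twiceBound≤2k : twiceBound S ≤ 2 * k
  twiceBound≤2k = begin
    twiceBound S
      ≡⟨ cong (λ n → 2 * invσ + 2 * ΣA + 2 * n + ΣE + 4ΣF) (ΣWhere-+ q inY _ _) ⟩
    2 * invσ + 2 * ΣA + 2 * (ΣBC + ΣD) + ΣE + 4ΣF
      ≡⟨ regroup invσ ΣA ΣBC ΣD ΣE 4ΣF ⟩
    2 * invσ + 2 * (ΣA + ΣBC) + (2 * ΣD + ΣE + 4ΣF)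
      ≤⟨ +-mono-≤ (+-mono-≤ 2invσ≤PP (*-monoʳ-≤ 2 ΣA+ΣBC≤QP)) 2ΣD+ΣE+4ΣF≤QQ ⟩
    PP + 2 * QP + QQ
      ≡⟨ split-QP PP QP QQ ⟩
    PP + QP + (QP + QQ)
      ≡⟨ sym ΣΣcharges≡ ⟩
    ΣV (λ a → ΣV (charges a))
      ≤⟨ ΣΣcharges≤2k ⟩
    2 * k ∎
    where
    open ≤-Reasoning
    regroup : ∀ i a b d e f → 2 * i + 2 * a + 2 * (b + d) + e + f ≡ 2 * i + 2 * (a + b) + (2 * d + e + f)
    regroup = solve-∀
    split-QP : ∀ a b c → a + 2 * b + c ≡ a + b + (b + c)
    split-QP = solve-∀

lemma3p1 : ∀ {p q : ℕ} → 1 ≤ p → (h₁ h₂ : List (V p q)) → IsBroom h₁ → IsBroom h₂ → (k : ℕ) → (S : RotSeq h₁ h₂ k) → twiceBound S ≤ 2 * k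
lemma3p1 _ h₁ h₂ T₁ T₂ k S = Bound.twiceBound≤2k (IsBroom.distinct T₁) (IsBroom.distinct T₂) S
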